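{- Let $0\le k\le d$, let $T'$ be a plane tree on $d+1-k$ vertices, let $p_1,\ldots,p_k$ be distinct elements of $\{2,\ldots,d\}$, and let $(\tau_1,\ldots,\tau_k)\in\{1,2\}^k$. Then there is a unique (up to isomorphism of plane trees) plane tree $T$ on $d+1$ vertices such that for each $s\in\{1,\ldots,k\}$ the vertex $v_s$ of $T$ with postorder label $p_s$ is a type $[\tau_s]$ special vertex, and removing the vertices $v_1,\ldots,v_k$ from $T$ yields $T'$.
   Context: A plane tree is a rooted tree whose children at each vertex are linearly ordered left to right; the first is the leftmost child; a leaf has no children. Postorder labeling of a plane tree on $n$ vertices: remove the root, label the subtrees rooted at the root's children, left to right, consecutively and each recursively in postorder, then give the root label $n$. Removal of a nonroot vertex $v$ with parent $w$: delete $v$ and replace $v$ in the ordered list of children of $w$ by the ordered list of children of $v$; removing several vertices in any order gives the same result. Special vertices: type $[1]$: a leaf that is not the leftmost child of its parent; type $[2]$: a non-leaf that is the leftmost child of its parent. -}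

module Defs where

open import Data.Nat using (ℕ; zero; suc; _+_; _≡ᵇ_)
open import Data.Bool using (Bool; true; false; if_then_else_)
open import Data.List using (List; []; _∷_; _++_; [_])
open import Data.Bool.ListAction using (any)
open import Data.Maybe using (Maybe; just; nothing)
open import Data.Product using (Σ; _×_; _,_)
open import Data.Unit using (⊤)
open import Data.Empty using (⊥)
open import Relation.Binary.PropositionalEquality using (_≡_)

-- A plane tree: a root with an ordered (left-to-right) list of subtrees.
-- Two plane trees are isomorphic iff they are equal as elements of PTree.
data PTree : Set where
  node : List PTree → PTree

children : PTree → List PTree
children (node cs) = cs

mutual
  size : PTree → ℕ
  size (node cs) = suc (sizeF cs)

  sizeF : List PTree → ℕ
  sizeF []       = zero
  sizeF (c ∷ cs) = size c + sizeF cs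

data Pos : Set where
  isRoot isLeftmost notLeftmost : Pos

-- Data recorded for each vertex: its position and whether it is a leaf.
VInfo : Set
VInfo = Pos × Bool

isNil : List PTree → Bool
isNil []      = true
isNil (_ ∷ _) = false

-- List of vertex data in postorder (i-th entry = vertex with postorder label i+1).
mutual
  postT : Pos → PTree → List VInfo
  postT pos (node cs) = postF cs ++ [ (pos , isNil cs) ]

  postF : List PTree → List VInfo
  postF []       = []
  postF (c ∷ cs) = postT isLeftmost c ++ postRest cs

  postRest : List PTree → List VInfo
  postRest []       = []
  postRest (c ∷ cs) = postT notLeftmost c ++ postRest cs

postorder : PTree → List VInfo
postorder T = postT isRoot T

nth : {A : Set} → List A → ℕ → Maybe A
nth []       _       = nothing
nth (x ∷ xs) zero    = just x
nth (x ∷ xs) (suc i) = nth xs i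

-- data of the vertex with postorder label p (labels are 1,…,n)
vertexAt : PTree → ℕ → Maybe VInfo
vertexAt T zero    = nothing
vertexAt T (suc i) = nth (postorder T) i

data SpecialType : Set where
  [1] [2] : SpecialType

HasType : SpecialType → VInfo → Set
HasType [1] (notLeftmost , true)  = ⊤
HasType [2] (isLeftmost  , false) = ⊤
HasType _   _                     = ⊥

IsSpecialAt : PTree → ℕ → SpecialType → Set
IsSpecialAt T p τ = Σ VInfo (λ i → (vertexAt T p ≡ just i) × HasType τ i)

-- Removal of all nonroot vertices whose postorder label satisfies S.
-- The offset o is the number of vertices preceding the subtree in postorder.
mutual
  removeT : (ℕ → Bool) → ℕ → PTree → List PTree
  removeT S o (node cs) =
    if S (o + size (node cs)) then removeF S o cs
    else [ node (removeF S o cs) ]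

  removeF : (ℕ → Bool) → ℕ → List PTree → List PTree
  removeF S o []       = []
  removeF S o (c ∷ cs) = removeT S o c ++ removeF S (o + size c) cs

removeLabels : (ℕ → Bool) → PTree → PTree
removeLabels S (node cs) = node (removeF S 0 cs)

inLabels : List ℕ → ℕ → Bool
inLabels ps q = any (λ p → p ≡ᵇ q) ps

module Submission where

-- A plane tree is determined by its postorder word: the list of
-- (position, is-leaf) data of its vertices in postorder.  A stack machine
-- reads such a word back into the tree, and whether it succeeds depends only
-- on the height of its stack.  Removing a set of special vertices from a tree
-- erases exactly their letters from the postorder word; conversely, a special
-- letter ([1] = non-leftmost leaf, [2] = leftmost non-leaf) read on a nonempty
-- stack leaves the stack height unchanged, so inserting prescribed special
-- letters at prescribed positions (never the first or the last) into the word
-- of T′ yields a word the machine still accepts, i.e. the postorder word of a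
-- tree T.  Hence T exists, and it is unique because a word is determined by
-- its erasure together with its letters at the erased positions.

open import Defs
open import Data.Nat using (ℕ; zero; suc; _+_; _∸_; _≤_; _<_; z≤n; s≤s; _≡ᵇ_)
open import Data.Nat.Properties
  using (+-suc; +-identityʳ; +-comm; suc-injective; m≤n⇒m≤1+n; ≡ᵇ⇒≡; ≡⇒≡ᵇ;
         m∸n+n≡m; <⇒≤; ≤-<-trans; m<m+n; m≤m+n; ≤-trans; ≤-refl; <-irrefl; ≤∧≢⇒<; 1+n≰n)
open import Data.Bool using (Bool; true; false; if_then_else_; _∨_)
open import Data.Bool.Properties using (∨-zeroʳ; T-≡)
open import Function.Bundles using (Equivalence)
open import Data.List using (List; []; _∷_; _++_; [_]; length)
open import Data.List.Properties using (++-assoc; ++-identityʳ; length-++; ∷-injective)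
open import Data.Maybe using (Maybe; just; nothing; is-just; maybe′; _>>=_)
import Data.Maybe as Maybe
open import Data.Maybe.Properties using (just-injective)
open import Data.Product using (_×_; _,_; ∃-syntax; ∃!; proj₁; proj₂)
open import Data.Unit using (⊤; tt)
open import Data.Empty using (⊥; ⊥-elim)
open import Data.Fin using (Fin; zero; suc)
import Data.Fin.Properties as FinProps
open import Data.Vec using (Vec; []; _∷_; lookup; toList)
open import Relation.Binary.PropositionalEquality
  using (_≡_; _≢_; refl; sym; trans; cong; cong₂; subst; module ≡-Reasoning)

-- Decoding postorder words.  An entry (c , cs) of the stack is a run of consecutive siblings, c being
-- the leftmost one, whose parent has not been read yet.
Stack : Set
Stack = List (PTree × List PTree)

-- The part of the postorder word that produced a stack.
flatten : Stack → List VInfo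
flatten []              = []
flatten ((c , cs) ∷ st) = flatten st ++ postF (c ∷ cs)

place : Pos → PTree → Stack → Maybe Stack
place isLeftmost  t st              = just ((t , []) ∷ st)
place notLeftmost t ((c , cs) ∷ st) = just ((c , cs ++ [ t ]) ∷ st)
place _           _ _               = nothing

step : Pos → Bool → Stack → Maybe Stack
step p true  st              = place p (node []) st
step p false ((c , cs) ∷ st) = place p (node (c ∷ cs)) st
step p false []              = nothing

finish : Stack → Bool → Maybe PTree
finish []             true  = just (node [])
finish ((c , cs) ∷ []) false = just (node (c ∷ cs))
finish _              _     = nothing

run : Stack → List VInfo → Maybe PTree
run st []                      = nothing
run st ((isRoot , b) ∷ [])     = finish st b
run st ((isRoot , b) ∷ _ ∷ _)  = nothing
run st ((isLeftmost , b) ∷ w)  = step isLeftmost b st >>= λ st′ → run st′ w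
run st ((notLeftmost , b) ∷ w) = step notLeftmost b st >>= λ st′ → run st′ w

data ChildPos : Pos → Set where
  first : ChildPos isLeftmost
  later : ChildPos notLeftmost

run-child : ∀ {p} → ChildPos p → ∀ b st w →
            run st ((p , b) ∷ w) ≡ (step p b st >>= λ st′ → run st′ w)
run-child first b st w = refl
run-child later b st w = refl

mutual
  run-postT : ∀ {p} → ChildPos p → ∀ t st w →
              run st (postT p t ++ w) ≡ (place p t st >>= λ st′ → run st′ w)
  run-postT c (node []) st w = run-child c true st w
  run-postT {p} c (node (e ∷ es)) st w = begin
      run st (((postT isLeftmost e ++ postRest es) ++ [ (p , false) ]) ++ w)
        ≡⟨ cong (run st) (++-assoc (postT isLeftmost e ++ postRest es) _ w) ⟩
      run st ((postT isLeftmost e ++ postRest es) ++ (p , false) ∷ w)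
        ≡⟨ cong (run st) (++-assoc (postT isLeftmost e) (postRest es) _) ⟩
      run st (postT isLeftmost e ++ postRest es ++ (p , false) ∷ w)
        ≡⟨ run-postT first e st _ ⟩
      run ((e , []) ∷ st) (postRest es ++ (p , false) ∷ w)
        ≡⟨ run-postRest es e [] st _ ⟩
      run ((e , es) ∷ st) ((p , false) ∷ w)
        ≡⟨ run-child c false _ w ⟩
      (place p (node (e ∷ es)) st >>= λ st′ → run st′ w) ∎
    where open ≡-Reasoning

  run-postRest : ∀ es c cs st w →
                 run ((c , cs) ∷ st) (postRest es ++ w) ≡ run ((c , cs ++ es) ∷ st) w
  run-postRest [] c cs st w = cong (λ z → run ((c , z) ∷ st) w) (sym (++-identityʳ cs))
  run-postRest (f ∷ fs) c cs st w = begin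
      run ((c , cs) ∷ st) ((postT notLeftmost f ++ postRest fs) ++ w)
        ≡⟨ cong (run ((c , cs) ∷ st)) (++-assoc (postT notLeftmost f) (postRest fs) w) ⟩
      run ((c , cs) ∷ st) (postT notLeftmost f ++ postRest fs ++ w)
        ≡⟨ run-postT later f _ _ ⟩
      run ((c , cs ++ [ f ]) ∷ st) (postRest fs ++ w)
        ≡⟨ run-postRest fs c (cs ++ [ f ]) st w ⟩
      run ((c , (cs ++ [ f ]) ++ fs) ∷ st) w
        ≡⟨ cong (λ z → run ((c , z) ∷ st) w) (++-assoc cs [ f ] fs) ⟩
      run ((c , cs ++ f ∷ fs) ∷ st) w ∎
    where open ≡-Reasoning

run-postorder : ∀ T → run [] (postorder T) ≡ just T
run-postorder (node []) = refl
run-postorder (node (e ∷ es)) = begin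
    run [] ((postT isLeftmost e ++ postRest es) ++ [ (isRoot , false) ])
      ≡⟨ cong (run []) (++-assoc (postT isLeftmost e) (postRest es) _) ⟩
    run [] (postT isLeftmost e ++ postRest es ++ [ (isRoot , false) ])
      ≡⟨ run-postT first e [] _ ⟩
    run ((e , []) ∷ []) (postRest es ++ [ (isRoot , false) ])
      ≡⟨ run-postRest es e [] [] _ ⟩
    just (node (e ∷ es)) ∎
  where open ≡-Reasoning

postorder-injective : ∀ {T₁ T₂} → postorder T₁ ≡ postorder T₂ → T₁ ≡ T₂
postorder-injective {T₁} {T₂} eq = just-injective (begin
    just T₁                ≡⟨ sym (run-postorder T₁) ⟩
    run [] (postorder T₁)  ≡⟨ cong (run []) eq ⟩
    run [] (postorder T₂)  ≡⟨ run-postorder T₂ ⟩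
    just T₂                ∎)
  where open ≡-Reasoning

postRest-++ : ∀ xs ys → postRest (xs ++ ys) ≡ postRest xs ++ postRest ys
postRest-++ []       ys = refl
postRest-++ (x ∷ xs) ys = trans (cong (postT notLeftmost x ++_) (postRest-++ xs ys))
                                (sym (++-assoc (postT notLeftmost x) (postRest xs) (postRest ys)))

place-flatten : ∀ p t st st′ → place p t st ≡ just st′ → flatten st′ ≡ flatten st ++ postT p t
place-flatten isLeftmost t st _ refl = cong (flatten st ++_) (++-identityʳ (postT isLeftmost t))
place-flatten notLeftmost t ((c , cs) ∷ st) _ refl = begin
    flatten st ++ postT isLeftmost c ++ postRest (cs ++ [ t ])
      ≡⟨ cong (λ z → flatten st ++ postT isLeftmost c ++ z) (postRest-++ cs [ t ]) ⟩
    flatten st ++ postT isLeftmost c ++ postRest cs ++ postT notLeftmost t ++ []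
      ≡⟨ cong (λ z → flatten st ++ postT isLeftmost c ++ postRest cs ++ z) (++-identityʳ _) ⟩
    flatten st ++ postT isLeftmost c ++ postRest cs ++ postT notLeftmost t
      ≡⟨ cong (flatten st ++_) (sym (++-assoc (postT isLeftmost c) (postRest cs) _)) ⟩
    flatten st ++ (postT isLeftmost c ++ postRest cs) ++ postT notLeftmost t
      ≡⟨ sym (++-assoc (flatten st) _ _) ⟩
    (flatten st ++ postT isLeftmost c ++ postRest cs) ++ postT notLeftmost t ∎
  where open ≡-Reasoning

step-flatten : ∀ p b st st′ → step p b st ≡ just st′ → flatten st′ ≡ flatten st ++ [ (p , b) ]
step-flatten p true  st st′ eq = place-flatten p (node []) st st′ eq
step-flatten p false ((c , cs) ∷ st) st′ eq =
  trans (place-flatten p (node (c ∷ cs)) st st′ eq)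
        (sym (++-assoc (flatten st) (postF (c ∷ cs)) [ (p , false) ]))

finish-sound : ∀ st b T → finish st b ≡ just T → postorder T ≡ flatten st ++ [ (isRoot , b) ]
finish-sound []              true  _ refl = refl
finish-sound ((c , cs) ∷ []) false _ refl = refl

mutual
  run-sound : ∀ st w T → run st w ≡ just T → postorder T ≡ flatten st ++ w
  run-sound st ((isRoot , b) ∷ [])     T eq = finish-sound st b T eq
  run-sound st ((isLeftmost , b) ∷ w)  T eq = step-sound isLeftmost b st w T eq
  run-sound st ((notLeftmost , b) ∷ w) T eq = step-sound notLeftmost b st w T eq

  step-sound : ∀ p b st w T → (step p b st >>= λ st′ → run st′ w) ≡ just T →
               postorder T ≡ flatten st ++ (p , b) ∷ w
  step-sound p b st w T eq with step p b st in e
  ... | just st′ = begin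
      postorder T                   ≡⟨ run-sound st′ w T eq ⟩
      flatten st′ ++ w              ≡⟨ cong (_++ w) (step-flatten p b st st′ e) ⟩
      (flatten st ++ [ (p , b) ]) ++ w ≡⟨ ++-assoc (flatten st) _ w ⟩
      flatten st ++ (p , b) ∷ w     ∎
    where open ≡-Reasoning

-- The stack machine seen through stack heights only.
hstep : Pos → Bool → ℕ → Maybe ℕ
hstep isLeftmost  true  h             = just (suc h)
hstep isLeftmost  false (suc h)       = just (suc h)
hstep notLeftmost true  (suc h)       = just (suc h)
hstep notLeftmost false (suc (suc h)) = just (suc h)
hstep _           _     _             = nothing

hfinish : ℕ → Bool → Bool
hfinish zero       true  = true
hfinish (suc zero) false = true
hfinish _          _     = false

accepts : ℕ → List VInfo → Bool
accepts h []                      = false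
accepts h ((isRoot , b) ∷ [])     = hfinish h b
accepts h ((isRoot , b) ∷ _ ∷ _)  = false
accepts h ((isLeftmost , b) ∷ w)  = maybe′ (λ h′ → accepts h′ w) false (hstep isLeftmost b h)
accepts h ((notLeftmost , b) ∷ w) = maybe′ (λ h′ → accepts h′ w) false (hstep notLeftmost b h)

accepts-child : ∀ {p} → ChildPos p → ∀ b h w →
                accepts h ((p , b) ∷ w) ≡ maybe′ (λ h′ → accepts h′ w) false (hstep p b h)
accepts-child first b h w = refl
accepts-child later b h w = refl

step-height : ∀ p b st → Maybe.map length (step p b st) ≡ hstep p b (length st)
step-height isRoot      true  st          = refl
step-height isRoot      false []          = refl
step-height isRoot      false (_ ∷ _)     = refl
step-height isLeftmost  true  st          = refl
step-height isLeftmost  false []          = refl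
step-height isLeftmost  false (_ ∷ _)     = refl
step-height notLeftmost true  []          = refl
step-height notLeftmost true  (_ ∷ _)     = refl
step-height notLeftmost false []          = refl
step-height notLeftmost false (_ ∷ [])    = refl
step-height notLeftmost false (_ ∷ _ ∷ _) = refl

finish-height : ∀ st b → is-just (finish st b) ≡ hfinish (length st) b
finish-height []          true  = refl
finish-height []          false = refl
finish-height (_ ∷ [])    true  = refl
finish-height (_ ∷ [])    false = refl
finish-height (_ ∷ _ ∷ _) true  = refl
finish-height (_ ∷ _ ∷ _) false = refl

mutual
  run-accepts : ∀ st w → is-just (run st w) ≡ accepts (length st) w
  run-accepts st []                      = refl
  run-accepts st ((isRoot , b) ∷ [])     = finish-height st b
  run-accepts st ((isRoot , b) ∷ _ ∷ _)  = refl
  run-accepts st ((isLeftmost , b) ∷ w)  = step-accepts isLeftmost b st w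
  run-accepts st ((notLeftmost , b) ∷ w) = step-accepts notLeftmost b st w

  step-accepts : ∀ p b st w → is-just (step p b st >>= λ st′ → run st′ w)
                              ≡ maybe′ (λ h′ → accepts h′ w) false (hstep p b (length st))
  step-accepts p b st w rewrite sym (step-height p b st) with step p b st
  ... | nothing  = refl
  ... | just st′ = run-accepts st′ w

hstep-positive : ∀ {p b h h′} → hstep p b h ≡ just h′ → 1 ≤ h′
hstep-positive {isLeftmost}  {true}  refl = s≤s z≤n
hstep-positive {isLeftmost}  {false} {suc _} refl = s≤s z≤n
hstep-positive {notLeftmost} {true}  {suc _} refl = s≤s z≤n
hstep-positive {notLeftmost} {false} {suc (suc _)} refl = s≤s z≤n

postorder-accepted : ∀ T → accepts 0 (postorder T) ≡ true
postorder-accepted T = trans (sym (run-accepts [] (postorder T))) (cong is-just (run-postorder T))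

accepted-decodes : ∀ w → accepts 0 w ≡ true → ∃[ T ] postorder T ≡ w
accepted-decodes w a with run [] w in e | trans (sym a) (sym (run-accepts [] w))
... | just T  | _  = T , run-sound [] w T e
... | nothing | ()

letter : SpecialType → VInfo
letter [1] = (notLeftmost , true)
letter [2] = (isLeftmost , false)

IsSpecial : VInfo → Set
IsSpecial x = ∃[ t ] x ≡ letter t

hasType⇒letter : ∀ t x → HasType t x → x ≡ letter t
hasType⇒letter [1] (notLeftmost , true)  _ = refl
hasType⇒letter [2] (isLeftmost  , false) _ = refl

letter-hasType : ∀ t → HasType t (letter t)
letter-hasType [1] = tt
letter-hasType [2] = tt

accepts-letter : ∀ t h w → accepts (suc h) (letter t ∷ w) ≡ accepts (suc h) w
accepts-letter [1] h w = refl
accepts-letter [2] h w = refl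

mutual
  length-postT : ∀ p t → length (postT p t) ≡ size t
  length-postT p (node cs) = begin
      length (postF cs ++ [ (p , isNil cs) ]) ≡⟨ length-++ (postF cs) ⟩
      length (postF cs) + 1                   ≡⟨ +-comm (length (postF cs)) 1 ⟩
      suc (length (postF cs))                 ≡⟨ cong suc (length-postF cs) ⟩
      suc (sizeF cs)                          ∎
    where open ≡-Reasoning

  length-postF : ∀ cs → length (postF cs) ≡ sizeF cs
  length-postF []       = refl
  length-postF (c ∷ cs) = trans (length-++ (postT isLeftmost c))
                                (cong₂ _+_ (length-postT isLeftmost c) (length-postRest cs))

  length-postRest : ∀ cs → length (postRest cs) ≡ sizeF cs
  length-postRest []       = refl
  length-postRest (c ∷ cs) = trans (length-++ (postT notLeftmost c))
                                   (cong₂ _+_ (length-postT notLeftmost c) (length-postRest cs))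

postFrom : Pos → List PTree → List VInfo
postFrom p []       = []
postFrom p (c ∷ cs) = postT p c ++ postRest cs

postF≡postFrom : ∀ cs → postF cs ≡ postFrom isLeftmost cs
postF≡postFrom []       = refl
postF≡postFrom (c ∷ cs) = refl

postRest≡postFrom : ∀ cs → postRest cs ≡ postFrom notLeftmost cs
postRest≡postFrom []       = refl
postRest≡postFrom (c ∷ cs) = refl

isNil-++ : ∀ (as bs : List PTree) → isNil as ≡ false → isNil (as ++ bs) ≡ false
isNil-++ (_ ∷ _) bs _ = refl

-- Words whose letters carry the labels i, i+1, …, and the labels marked by S.
module Erasure (S : ℕ → Bool) where

  Marked : ℕ → List VInfo → Set
  Marked i []      = ⊤
  Marked i (x ∷ u) = (S i ≡ true → IsSpecial x) × Marked (suc i) u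

  erase : ℕ → List VInfo → List VInfo
  erase i []      = []
  erase i (x ∷ u) = if S i then erase (suc i) u else x ∷ erase (suc i) u

  Marked-++ : ∀ i u v → Marked i (u ++ v) → Marked i u × Marked (i + length u) v
  Marked-++ i [] v m rewrite +-identityʳ i = tt , m
  Marked-++ i (x ∷ u) v (mx , m) with Marked-++ (suc i) u v m
  ... | mu , mv rewrite +-suc i (length u) = (mx , mu) , mv

  erase-++ : ∀ i u v → erase i (u ++ v) ≡ erase i u ++ erase (i + length u) v
  erase-++ i [] v rewrite +-identityʳ i = refl
  erase-++ i (x ∷ u) v rewrite +-suc i (length u) with S i
  ... | true  = erase-++ (suc i) u v
  ... | false = cong (x ∷_) (erase-++ (suc i) u v)

  Marked-from-nth : ∀ i u → (∀ j x → S (i + j) ≡ true → nth u j ≡ just x → IsSpecial x) →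
                    Marked i u
  Marked-from-nth i []      h = tt
  Marked-from-nth i (x ∷ u) h =
    (λ e → h 0 x (trans (cong S (+-identityʳ i)) e) refl) ,
    Marked-from-nth (suc i) u (λ j y e → h (suc j) y (trans (cong S (+-suc i j)) e))

  erase-cons : ∀ i x y u v → (S i ≡ true → x ≡ y) → erase i (x ∷ u) ≡ erase i (y ∷ v) →
               x ≡ y × erase (suc i) u ≡ erase (suc i) v
  erase-cons i x y u v same er with S i
  ... | true  = same refl , er
  ... | false = ∷-injective er

  erase-injective : ∀ i u v → length u ≡ length v →
                    (∀ j → S (i + j) ≡ true → nth u j ≡ nth v j) →
                    erase i u ≡ erase i v → u ≡ v
  erase-injective i []      []      _ _ _ = refl
  erase-injective i (x ∷ u) (y ∷ v) l agree er =
    cong₂ _∷_ (proj₁ heads) (erase-injective (suc i) u v (suc-injective l) agree′ (proj₂ heads))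
    where
    heads : x ≡ y × erase (suc i) u ≡ erase (suc i) v
    heads = erase-cons i x y u v
              (λ s → just-injective (agree 0 (trans (cong S (+-identityʳ i)) s))) er
    agree′ : ∀ j → S (suc i + j) ≡ true → nth u j ≡ nth v j
    agree′ j s = agree (suc j) (trans (cong S (+-suc i j)) s)

  -- Removal of marked special vertices erases their letters.  A subtree with
  -- offset o has labels o+1, …, and its root has label o + size.
  root-label : ∀ o ds → suc o + length (postF ds) ≡ o + suc (sizeF ds)
  root-label o ds = trans (cong (suc o +_) (length-postF ds)) (sym (+-suc o (sizeF ds)))

  erase-postT : ∀ o p ds → erase (suc o) (postT p (node ds)) ≡
                erase (suc o) (postF ds) ++ (if S (o + suc (sizeF ds)) then [] else [ (p , isNil ds) ])
  erase-postT o p ds = trans (erase-++ (suc o) (postF ds) [ (p , isNil ds) ])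
    (cong (λ j → erase (suc o) (postF ds) ++ (if S j then [] else [ (p , isNil ds) ]))
          (root-label o ds))

  Marked-children : ∀ o p ds → Marked (suc o) (postT p (node ds)) → Marked (suc o) (postF ds)
  Marked-children o p ds m = proj₁ (Marked-++ (suc o) (postF ds) _ m)

  Marked-root : ∀ o p ds → Marked (suc o) (postT p (node ds)) →
                S (o + suc (sizeF ds)) ≡ true → IsSpecial (p , isNil ds)
  Marked-root o p ds m s =
    proj₁ (proj₂ (Marked-++ (suc o) (postF ds) _ m)) (trans (cong S (root-label o ds)) s)

  -- A leftmost child never disappears completely: if it is removed, it is of
  -- type [2], so it has children, and its own leftmost child survives.
  mutual
    removeT-nonempty : ∀ o c → Marked (suc o) (postT isLeftmost c) →
                       isNil (removeT S o c) ≡ false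
    removeT-nonempty o (node ds) m with S (o + suc (sizeF ds)) in s
    ... | false = refl
    removeT-nonempty o (node []) m | true with Marked-root o isLeftmost [] m s
    ... | [1] , ()
    ... | [2] , ()
    removeT-nonempty o (node (e ∷ es)) m | true =
      removeF-nonempty o e es (Marked-children o isLeftmost (e ∷ es) m)

    removeF-nonempty : ∀ o c cs → Marked (suc o) (postF (c ∷ cs)) →
                       isNil (removeF S o (c ∷ cs)) ≡ false
    removeF-nonempty o c cs m =
      isNil-++ (removeT S o c) _ (removeT-nonempty o c (proj₁ (Marked-++ (suc o) (postT isLeftmost c) _ m)))

  mutual
    post-removeT : ∀ {p} → ChildPos p → ∀ o c X → Marked (suc o) (postT p c) →
                   postFrom p (removeT S o c ++ X) ≡ erase (suc o) (postT p c) ++ postRest X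
    post-removeT {p} cp o (node ds) X m rewrite erase-postT o p ds with S (o + suc (sizeF ds)) in s
    post-removeT {p} cp o (node []) X m | true with Marked-root o p [] m s | cp
    ... | [1] , refl | later = sym (postRest≡postFrom X)
    ... | [2] , ()   | _
    post-removeT {p} cp o (node (e ∷ es)) X m | true with Marked-root o p (e ∷ es) m s | cp
    ... | [1] , ()   | _
    ... | [2] , refl | first = trans (post-removeF first o e es X (Marked-children o p (e ∷ es) m))
                                     (cong (_++ postRest X) (sym (++-identityʳ _)))
    post-removeT {p} cp o (node []) X m | false = refl
    post-removeT {p} cp o (node (e ∷ es)) X m | false =
      cong (_++ postRest X)
        (cong₂ (λ a b → a ++ [ (p , b) ]) (post-removeF-alone o e es mc) (removeF-nonempty o e es mc))
      where
      mc : Marked (suc o) (postF (e ∷ es))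
      mc = Marked-children o p (e ∷ es) m

    post-removeF-alone : ∀ o e es → Marked (suc o) (postF (e ∷ es)) →
                         postF (removeF S o (e ∷ es)) ≡ erase (suc o) (postF (e ∷ es))
    post-removeF-alone o e es m = begin
        postF R                            ≡⟨ postF≡postFrom R ⟩
        postFrom isLeftmost R              ≡⟨ cong (postFrom isLeftmost) (sym (++-identityʳ R)) ⟩
        postFrom isLeftmost (R ++ [])      ≡⟨ post-removeF first o e es [] m ⟩
        erase (suc o) (postF (e ∷ es)) ++ [] ≡⟨ ++-identityʳ _ ⟩
        erase (suc o) (postF (e ∷ es))     ∎
      where
      open ≡-Reasoning
      R : List PTree
      R = removeF S o (e ∷ es)

    post-removeF : ∀ {p} → ChildPos p → ∀ o c cs X → Marked (suc o) (postFrom p (c ∷ cs)) →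
                   postFrom p (removeF S o (c ∷ cs) ++ X) ≡
                   erase (suc o) (postFrom p (c ∷ cs)) ++ postRest X
    post-removeF {p} cp o c cs X m = begin
        postFrom p ((removeT S o c ++ removeF S (o + size c) cs) ++ X)
          ≡⟨ cong (postFrom p) (++-assoc (removeT S o c) _ X) ⟩
        postFrom p (removeT S o c ++ removeF S (o + size c) cs ++ X)
          ≡⟨ post-removeT cp o c _ mc ⟩
        erase (suc o) (postT p c) ++ postRest (removeF S (o + size c) cs ++ X)
          ≡⟨ cong (erase (suc o) (postT p c) ++_) (postRest-removeF (o + size c) cs X mcs) ⟩
        erase (suc o) (postT p c) ++ erase (suc (o + size c)) (postRest cs) ++ postRest X
          ≡⟨ sym (++-assoc (erase (suc o) (postT p c)) _ _) ⟩
        (erase (suc o) (postT p c) ++ erase (suc (o + size c)) (postRest cs)) ++ postRest X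
          ≡⟨ cong (λ j → (erase (suc o) (postT p c) ++ erase j (postRest cs)) ++ postRest X)
                  (sym next) ⟩
        (erase (suc o) (postT p c) ++ erase (suc o + length (postT p c)) (postRest cs)) ++ postRest X
          ≡⟨ cong (_++ postRest X) (sym (erase-++ (suc o) (postT p c) (postRest cs))) ⟩
        erase (suc o) (postT p c ++ postRest cs) ++ postRest X ∎
      where
      open ≡-Reasoning
      next : suc o + length (postT p c) ≡ suc (o + size c)
      next = cong (suc o +_) (length-postT p c)
      mc : Marked (suc o) (postT p c)
      mc = proj₁ (Marked-++ (suc o) (postT p c) (postRest cs) m)
      mcs : Marked (suc (o + size c)) (postRest cs)
      mcs = subst (λ j → Marked j (postRest cs)) next
                  (proj₂ (Marked-++ (suc o) (postT p c) (postRest cs) m))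

    postRest-removeF : ∀ o cs X → Marked (suc o) (postRest cs) →
                       postRest (removeF S o cs ++ X) ≡ erase (suc o) (postRest cs) ++ postRest X
    postRest-removeF o []       X m = refl
    postRest-removeF o (c ∷ cs) X m =
      trans (postRest≡postFrom (removeF S o (c ∷ cs) ++ X)) (post-removeF later o c cs X m)

  postorder-removeLabels : ∀ T → Marked 1 (postorder T) → S (size T) ≡ false →
                           postorder (removeLabels S T) ≡ erase 1 (postorder T)
  postorder-removeLabels (node []) m s rewrite s = refl
  postorder-removeLabels (node (e ∷ es)) m s = begin
      postF R ++ [ (isRoot , isNil R) ]
        ≡⟨ cong₂ (λ a b → a ++ [ (isRoot , b) ]) (post-removeF-alone 0 e es mc)
                 (removeF-nonempty 0 e es mc) ⟩
      erase 1 (postF (e ∷ es)) ++ [ (isRoot , false) ]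
        ≡⟨ cong (erase 1 (postF (e ∷ es)) ++_) (sym root-kept) ⟩
      erase 1 (postF (e ∷ es)) ++ erase (1 + length (postF (e ∷ es))) [ (isRoot , false) ]
        ≡⟨ sym (erase-++ 1 (postF (e ∷ es)) _) ⟩
      erase 1 (postF (e ∷ es) ++ [ (isRoot , false) ]) ∎
    where
    open ≡-Reasoning
    R : List PTree
    R = removeF S 0 (e ∷ es)
    mc : Marked 1 (postF (e ∷ es))
    mc = proj₁ (Marked-++ 1 (postF (e ∷ es)) _ m)
    root-kept : erase (1 + length (postF (e ∷ es))) [ (isRoot , false) ] ≡ [ (isRoot , false) ]
    root-kept rewrite length-postF (e ∷ es) | s = refl

count : (ℕ → Bool) → ℕ → ℕ → ℕ
count S i zero    = 0
count S i (suc n) = if S i then suc (count S (suc i) n) else count S (suc i) n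

count≤ : ∀ S i n → count S i n ≤ n
count≤ S i zero = z≤n
count≤ S i (suc n) with S i
... | true  = s≤s (count≤ S (suc i) n)
... | false = m≤n⇒m≤1+n (count≤ S (suc i) n)

count-full : ∀ S i m → count S i (suc m) ≡ suc m → S (i + m) ≡ true
count-full S i m full with S i in s
count-full S i zero    full | true rewrite +-identityʳ i = s
count-full S i (suc m) full | true rewrite +-suc i m = count-full S (suc i) m (suc-injective full)
... | false = ⊥-elim (1+n≰n (subst (_≤ m) full (count≤ S (suc i) m)))

module Insertion (S : ℕ → Bool) (g : ℕ → SpecialType) where
  open Erasure S

  -- insert i n w: the word with labels i, …, i+n-1 having the letter of g at
  -- marked labels and the letters of w, in order, at the others (a root
  -- letter fills in should w run out, which never happens when
  -- length w + count S i n ≡ n).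
  mutual
    insert : ℕ → ℕ → List VInfo → List VInfo
    insert i zero    w = []
    insert i (suc n) w = insertAt (S i) i n w

    insertAt : Bool → ℕ → ℕ → List VInfo → List VInfo
    insertAt true  i n w       = letter (g i) ∷ insert (suc i) n w
    insertAt false i n []      = (isRoot , true) ∷ insert (suc i) n []
    insertAt false i n (x ∷ w) = x ∷ insert (suc i) n w

  length-insert : ∀ i n w → length (insert i n w) ≡ n
  length-insert i zero w = refl
  length-insert i (suc n) w with S i
  length-insert i (suc n) w       | true  = cong suc (length-insert (suc i) n w)
  length-insert i (suc n) []      | false = cong suc (length-insert (suc i) n [])
  length-insert i (suc n) (x ∷ w) | false = cong suc (length-insert (suc i) n w)

  insert-letters : ∀ n i w j → j < n → S (i + j) ≡ true →
                   nth (insert i n w) j ≡ just (letter (g (i + j)))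
  insert-letters (suc n) i w zero _ s rewrite +-identityʳ i | s = refl
  insert-letters (suc n) i w (suc j) (s≤s j<n) s rewrite +-suc i j with S i
  ... | true  = insert-letters n (suc i) w j j<n s
  insert-letters (suc n) i []      (suc j) (s≤s j<n) s | false = insert-letters n (suc i) [] j j<n s
  insert-letters (suc n) i (x ∷ w) (suc j) (s≤s j<n) s | false = insert-letters n (suc i) w j j<n s

  erase-insert : ∀ n i w → length w + count S i n ≡ n → erase i (insert i n w) ≡ w
  erase-insert zero    i []      _ = refl
  erase-insert (suc n) i w l with S i in s
  ... | true  rewrite s = erase-insert n (suc i) w (suc-injective (trans (sym (+-suc (length w) _)) l))
  erase-insert (suc n) i []      l | false = ⊥-elim (1+n≰n (subst (_≤ n) l (count≤ S (suc i) n)))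
  erase-insert (suc n) i (x ∷ w) l | false rewrite s = cong (x ∷_) (erase-insert n (suc i) w (suc-injective l))

  LastUnmarked : ℕ → ℕ → Set
  LastUnmarked i zero    = ⊤
  LastUnmarked i (suc m) = S (i + m) ≡ false

  LastUnmarked-suc : ∀ i m → LastUnmarked i (suc m) → LastUnmarked (suc i) m
  LastUnmarked-suc i zero    _ = tt
  LastUnmarked-suc i (suc m) s = trans (cong S (sym (+-suc i m))) s

  mutual
    insert-accepted : ∀ n i w h → accepts h w ≡ true → length w + count S i n ≡ n →
                      LastUnmarked i n → (S i ≡ true → 1 ≤ h) →
                      accepts h (insert i n w) ≡ true
    insert-accepted zero i [] h () _ _ _
    insert-accepted (suc m) i w h a l last nonempty with S i in s
    insert-accepted (suc m) i w (suc h) a l last nonempty | true =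
      trans (accepts-letter (g i) h _)
            (insert-accepted m (suc i) w (suc h) a (suc-injective (trans (sym (+-suc (length w) _)) l))
                             (LastUnmarked-suc i m last) (λ _ → s≤s z≤n))
    insert-accepted (suc m) i w zero a l last nonempty | true with nonempty refl
    ... | ()
    insert-accepted (suc m) i [] h () l last nonempty | false
    insert-accepted (suc m) i ((isRoot , b) ∷ []) h a l last nonempty | false =
      root-last m (suc-injective l) last
      where
      root-last : ∀ m → count S (suc i) m ≡ m → LastUnmarked i (suc m) →
                  accepts h ((isRoot , b) ∷ insert (suc i) m []) ≡ true
      root-last zero    _    _    = a
      root-last (suc k) full last′ with trans (sym last′) (trans (cong S (+-suc i k)) (count-full S (suc i) k full))
      ... | ()
    insert-accepted (suc m) i ((isLeftmost , b) ∷ w) h a l last nonempty | false =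
      insert-after first b w h m i a (suc-injective l) (LastUnmarked-suc i m last)
    insert-accepted (suc m) i ((notLeftmost , b) ∷ w) h a l last nonempty | false =
      insert-after later b w h m i a (suc-injective l) (LastUnmarked-suc i m last)

    insert-after : ∀ {p} → ChildPos p → ∀ b w h m i → accepts h ((p , b) ∷ w) ≡ true →
                   length w + count S (suc i) m ≡ m → LastUnmarked (suc i) m →
                   accepts h ((p , b) ∷ insert (suc i) m w) ≡ true
    insert-after {p} cp b w h m i a l last
      rewrite accepts-child cp b h w | accepts-child cp b h (insert (suc i) m w)
      with hstep p b h in e
    ... | just h′ = insert-accepted m (suc i) w h′ a l last (λ _ → hstep-positive e)

module Reconstruction (S : ℕ → Bool) (g : ℕ → SpecialType) where
  open Erasure S
  open Insertion S g

  Prescribed : PTree → Set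
  Prescribed T = ∀ q → S q ≡ true → vertexAt T q ≡ just (letter (g q))

  MarkedWithin : ℕ → Set
  MarkedWithin n = ∀ q → S q ≡ true → 2 ≤ q × q < n

  unmarked-1 : ∀ {n} → MarkedWithin n → S 1 ≡ false
  unmarked-1 within with S 1 in s
  ... | false = refl
  ... | true with proj₁ (within 1 s)
  ...   | s≤s ()

  unmarked-bound : ∀ {n} → MarkedWithin n → S n ≡ false
  unmarked-bound {n} within with S n in s
  ... | false = refl
  ... | true  = ⊥-elim (<-irrefl refl (proj₂ (within n s)))

  unmarked-last : ∀ n → MarkedWithin n → LastUnmarked 1 n
  unmarked-last zero    within = tt
  unmarked-last (suc m) within = unmarked-bound within

  prescribed-marked : ∀ T → Prescribed T → Marked 1 (postorder T)
  prescribed-marked T pr = Marked-from-nth 1 (postorder T)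
    (λ j x s at → g (suc j) , just-injective (trans (sym at) (pr (suc j) s)))

  removal-erases : ∀ {n} T → MarkedWithin n → size T ≡ n → Prescribed T →
                   postorder (removeLabels S T) ≡ erase 1 (postorder T)
  removal-erases T within refl pr =
    postorder-removeLabels T (prescribed-marked T pr) (unmarked-bound within)

  -- Existence: decode the word of T′ with the prescribed letters inserted.
  reconstruct-exists : ∀ n T′ → MarkedWithin n → size T′ + count S 1 n ≡ n →
                       ∃[ T ] size T ≡ n × Prescribed T × removeLabels S T ≡ T′
  reconstruct-exists n T′ within total = T , size-T , prescribed-T , removal-T
    where
    w′ : List VInfo
    w′ = postorder T′
    total′ : length w′ + count S 1 n ≡ n
    total′ = trans (cong (_+ count S 1 n) (length-postT isRoot T′)) total
    first-unmarked : S 1 ≡ true → 1 ≤ 0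
    first-unmarked s with trans (sym s) (unmarked-1 within)
    ... | ()
    decoded : ∃[ T ] postorder T ≡ insert 1 n w′
    decoded = accepted-decodes (insert 1 n w′)
      (insert-accepted n 1 w′ 0 (postorder-accepted T′) total′ (unmarked-last n within) first-unmarked)
    T : PTree
    T = proj₁ decoded
    size-T : size T ≡ n
    size-T = trans (sym (length-postT isRoot T))
                   (trans (cong length (proj₂ decoded)) (length-insert 1 n w′))
    prescribed-T : Prescribed T
    prescribed-T zero    s with proj₁ (within 0 s)
    ... | ()
    prescribed-T (suc j) s = trans (cong (λ u → nth u j) (proj₂ decoded))
                                   (insert-letters n 1 w′ j (<⇒≤ (proj₂ (within (suc j) s))) s)
    removal-T : removeLabels S T ≡ T′
    removal-T = postorder-injective (begin
      postorder (removeLabels S T)  ≡⟨ removal-erases T within size-T prescribed-T ⟩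
      erase 1 (postorder T)         ≡⟨ cong (erase 1) (proj₂ decoded) ⟩
      erase 1 (insert 1 n w′)       ≡⟨ erase-insert n 1 w′ total′ ⟩
      w′                            ∎)
      where open ≡-Reasoning

  -- Uniqueness: two such trees have postorder words of equal length, equal
  -- letters at the marked labels and equal erasures.
  reconstruct-unique : ∀ n T₁ T₂ → MarkedWithin n → size T₁ ≡ n → size T₂ ≡ n →
                       Prescribed T₁ → Prescribed T₂ → removeLabels S T₁ ≡ removeLabels S T₂ →
                       T₁ ≡ T₂
  reconstruct-unique n T₁ T₂ within size₁ size₂ pr₁ pr₂ same =
    postorder-injective (erase-injective 1 (postorder T₁) (postorder T₂) lengths agree erasures)
    where
    open ≡-Reasoning
    lengths : length (postorder T₁) ≡ length (postorder T₂)
    lengths = begin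
      length (postorder T₁)  ≡⟨ length-postT isRoot T₁ ⟩
      size T₁                ≡⟨ trans size₁ (sym size₂) ⟩
      size T₂                ≡⟨ sym (length-postT isRoot T₂) ⟩
      length (postorder T₂)  ∎
    agree : ∀ j → S (suc j) ≡ true → nth (postorder T₁) j ≡ nth (postorder T₂) j
    agree j s = trans (pr₁ (suc j) s) (sym (pr₂ (suc j) s))
    erasures : erase 1 (postorder T₁) ≡ erase 1 (postorder T₂)
    erasures = begin
      erase 1 (postorder T₁)         ≡⟨ sym (removal-erases T₁ within size₁ pr₁) ⟩
      postorder (removeLabels S T₁)  ≡⟨ cong postorder same ⟩
      postorder (removeLabels S T₂)  ≡⟨ removal-erases T₂ within size₂ pr₂ ⟩
      erase 1 (postorder T₂)         ∎

  reconstruct : ∀ n T′ → MarkedWithin n → size T′ + count S 1 n ≡ n →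
                ∃! _≡_ (λ T → size T ≡ n × Prescribed T × removeLabels S T ≡ T′)
  reconstruct n T′ within total with reconstruct-exists n T′ within total
  ... | T , size-T , pr , removal =
    T , (size-T , pr , removal) ,
    λ { (size₂ , pr₂ , removal₂) →
          reconstruct-unique n T _ within size-T size₂ pr pr₂ (trans removal (sym removal₂)) }

Distinct : ∀ {k} → Vec ℕ k → Set
Distinct {k} p = ∀ (s t : Fin k) → lookup p s ≡ lookup p t → s ≡ t

Distinct-tail : ∀ {k} x (p : Vec ℕ k) → Distinct (x ∷ p) → Distinct p
Distinct-tail x p distinct s t e = FinProps.suc-injective (distinct (suc s) (suc t) e)

≡ᵇ-refl : ∀ x → (x ≡ᵇ x) ≡ true
≡ᵇ-refl x = Equivalence.to T-≡ (≡⇒≡ᵇ x x refl)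

≡ᵇ-true : ∀ {x y} → (x ≡ᵇ y) ≡ true → x ≡ y
≡ᵇ-true {x} {y} e = ≡ᵇ⇒≡ x y (Equivalence.from T-≡ e)

≡ᵇ-false : ∀ {x y} → x ≢ y → (x ≡ᵇ y) ≡ false
≡ᵇ-false {x} {y} x≢y with x ≡ᵇ y in e
... | true  = ⊥-elim (x≢y (≡ᵇ-true e))
... | false = refl

inLabels-lookup : ∀ {k} (p : Vec ℕ k) s → inLabels (toList p) (lookup p s) ≡ true
inLabels-lookup (x ∷ p) zero rewrite ≡ᵇ-refl x = refl
inLabels-lookup (x ∷ p) (suc s) =
  trans (cong ((x ≡ᵇ lookup p s) ∨_) (inLabels-lookup p s)) (∨-zeroʳ _)

inLabels-witness : ∀ {k} (p : Vec ℕ k) q → inLabels (toList p) q ≡ true → ∃[ s ] lookup p s ≡ q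
inLabels-witness (x ∷ p) q e with x ≡ᵇ q in e₁
... | true  = zero , ≡ᵇ-true e₁
... | false with inLabels-witness p q e
...   | s , at = suc s , at

inLabels-absent : ∀ {k} (p : Vec ℕ k) q → (∀ s → lookup p s ≢ q) → inLabels (toList p) q ≡ false
inLabels-absent p q absent with inLabels (toList p) q in e
... | true  = ⊥-elim (absent (proj₁ (inLabels-witness p q e)) (proj₂ (inLabels-witness p q e)))
... | false = refl

-- the type prescribed for label q (arbitrary if q is not among the labels)
typeOf : ∀ {k} → Vec ℕ k → Vec SpecialType k → ℕ → SpecialType
typeOf []      []      q = [1]
typeOf (x ∷ p) (t ∷ τ) q = if x ≡ᵇ q then t else typeOf p τ q

typeOf-lookup : ∀ {k} (p : Vec ℕ k) τ → Distinct p → ∀ s → typeOf p τ (lookup p s) ≡ lookup τ s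
typeOf-lookup (x ∷ p) (t ∷ τ) distinct zero rewrite ≡ᵇ-refl x = refl
typeOf-lookup (x ∷ p) (t ∷ τ) distinct (suc s)
  rewrite ≡ᵇ-false {x} {lookup p s} (λ e → FinProps.0≢1+n (distinct zero (suc s) e)) =
  typeOf-lookup p τ (Distinct-tail x p distinct) s

≡ᵇ-false⇒≢ : ∀ {x y} → (x ≡ᵇ y) ≡ false → x ≢ y
≡ᵇ-false⇒≢ {x} e refl with trans (sym (≡ᵇ-refl x)) e
... | ()

count-add-before : ∀ P x i n → x < i → count (λ q → (x ≡ᵇ q) ∨ P q) i n ≡ count P i n
count-add-before P x i zero    x<i = refl
count-add-before P x i (suc n) x<i rewrite ≡ᵇ-false (λ e → <-irrefl e x<i) =
  cong (λ m → if P i then suc m else m) (count-add-before P x (suc i) n (m≤n⇒m≤1+n x<i))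

if-suc : ∀ b {m n : ℕ} → m ≡ suc n → (if b then suc m else m) ≡ suc (if b then suc n else n)
if-suc true  e = cong suc e
if-suc false e = e

count-add : ∀ P x i n → P x ≡ false → i ≤ x → x < i + n →
            count (λ q → (x ≡ᵇ q) ∨ P q) i n ≡ suc (count P i n)
count-add P x i zero    Px i≤x x<i rewrite +-identityʳ i = ⊥-elim (<-irrefl refl (≤-trans x<i i≤x))
count-add P x i (suc n) Px i≤x x<i+n with x ≡ᵇ i in e
... | true with refl ← ≡ᵇ-true {x} {i} e rewrite Px = cong suc (count-add-before P x (suc x) n ≤-refl)
... | false = if-suc (P i) (count-add P x (suc i) n Px i<x (subst (x <_) (+-suc i n) x<i+n))
  where
  i<x : i < x
  i<x = ≤∧≢⇒< i≤x (λ i≡x → ≡ᵇ-false⇒≢ e (sym i≡x))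

count-labels : ∀ {k} (p : Vec ℕ k) i n → (∀ s → i ≤ lookup p s × lookup p s < i + n) →
               Distinct p → count (inLabels (toList p)) i n ≡ k
count-labels []      i n range distinct = count-none i n
  where
  count-none : ∀ i n → count (inLabels []) i n ≡ 0
  count-none i zero    = refl
  count-none i (suc n) = count-none (suc i) n
count-labels (x ∷ p) i n range distinct = begin
    count (λ q → (x ≡ᵇ q) ∨ inLabels (toList p) q) i n
      ≡⟨ count-add (inLabels (toList p)) x i n x-new (proj₁ (range zero)) (proj₂ (range zero)) ⟩
    suc (count (inLabels (toList p)) i n)
      ≡⟨ cong suc (count-labels p i n (λ s → range (suc s)) (Distinct-tail x p distinct)) ⟩
    suc _ ∎
  where
  open ≡-Reasoning
  x-new : inLabels (toList p) x ≡ false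
  x-new = inLabels-absent p x (λ s e → FinProps.0≢1+n (sym (distinct (suc s) zero e)))

module LabelMarking {k} (p : Vec ℕ k) (τ : Vec SpecialType k) (distinct : Distinct p) where
  open Reconstruction (inLabels (toList p)) (typeOf p τ)

  prescribed⇒special : ∀ T → Prescribed T → ∀ s → IsSpecialAt T (lookup p s) (lookup τ s)
  prescribed⇒special T pr s =
    letter (lookup τ s) ,
    subst (λ t → vertexAt T (lookup p s) ≡ just (letter t)) (typeOf-lookup p τ distinct s)
          (pr (lookup p s) (inLabels-lookup p s)) ,
    letter-hasType (lookup τ s)

  special⇒prescribed : ∀ T → (∀ s → IsSpecialAt T (lookup p s) (lookup τ s)) → Prescribed T
  special⇒prescribed T special q marked with inLabels-witness p q marked
  ... | s , refl with special s
  ...   | x , at , hasType rewrite typeOf-lookup p τ distinct s =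
    trans at (cong just (hasType⇒letter (lookup τ s) x hasType))

∃!-≡-cong : ∀ {A : Set} {P Q : A → Set} → (∀ x → P x → Q x) → (∀ x → Q x → P x) →
            ∃! _≡_ P → ∃! _≡_ Q
∃!-≡-cong P⇒Q Q⇒P (x , Px , unique) = x , P⇒Q x Px , λ {y} Qy → unique (Q⇒P y Qy)

proposition3p11 : (d k : ℕ) → k ≤ d →
    (T′ : PTree) → size T′ ≡ d + 1 ∸ k →
    (p : Vec ℕ k) → (∀ s → 2 ≤ lookup p s × lookup p s ≤ d) →
    (∀ s t → lookup p s ≡ lookup p t → s ≡ t) →
    (τ : Vec SpecialType k) →
    ∃! _≡_ (λ T → size T ≡ d + 1
                × (∀ (s : Fin k) → IsSpecialAt T (lookup p s) (lookup τ s))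
                × removeLabels (inLabels (toList p)) T ≡ T′)
proposition3p11 d k k≤d T′ size-T′ p range distinct τ =
  ∃!-≡-cong (λ T (size-T , pr , removal) → size-T , prescribed⇒special T pr , removal)
            (λ T (size-T , sp , removal) → size-T , special⇒prescribed T sp , removal)
            (reconstruct (d + 1) T′ within total)
  where
  open Reconstruction (inLabels (toList p)) (typeOf p τ)
  open LabelMarking p τ distinct
  below : ∀ s → lookup p s < d + 1
  below s = ≤-<-trans (proj₂ (range s)) (m<m+n d (s≤s z≤n))
  within : MarkedWithin (d + 1)
  within q marked with inLabels-witness p q marked
  ... | s , refl = proj₁ (range s) , below s
  total : size T′ + count (inLabels (toList p)) 1 (d + 1) ≡ d + 1
  total = trans (cong₂ _+_ size-T′
                  (count-labels p 1 (d + 1) (λ s → ≤-trans (s≤s z≤n) (proj₁ (range s)) ,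
                                                    m≤n⇒m≤1+n (below s)) distinct))
                (m∸n+n≡m (≤-trans k≤d (m≤m+n d 1)))
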